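{- For all integers $n>1$ and $k>n$ we have $3F(n,k)\le2F(n,k+1)$, with equality if and only if $n=2$ and $k=4$.
   Context: For positive integers $n,k$, $F(n,k)$ is defined by: $F(n,k)=0$ if $1\le k<n$; $F(n,k)=1$ if $k=n$; and $F(n,k)=\sum_{j=1}^nF(n,k-j)$ if $k>n$. -}

module Defs where

open import Data.Nat using (ℕ; zero; suc; _+_; _<_; _≤_)
open import Data.Nat.Properties using (_<?_; _≟_)
open import Data.List using (List; []; _∷_; take)
open import Data.Nat.ListAction using (sum)
open import Relation.Nullary using (yes; no)

-- hist n k = [ F(n,k) , F(n,k-1) , … , F(n,1) ]  (list of length k),
-- computed by recursion on k.
hist : ℕ → ℕ → List ℕ
hist n zero = []
hist n (suc m) with suc m <? n
... | yes _ = 0 ∷ hist n m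
... | no _ with suc m ≟ n
...   | yes _ = 1 ∷ hist n m
...   | no _ = sum (take n (hist n m)) ∷ hist n m

-- F n k for positive integers n, k (F n 0 is a junk value 0, never used).
F : ℕ → ℕ → ℕ
F n k with hist n k
... | [] = 0
... | x ∷ _ = x

-- Unfolding the recurrence twice gives, for k = m + 1 > n,
--   F(n,k) = T + F(n,k-n)  and  F(n,k+1) = F(n,k) + T,  where T = F(n,k-1) + ⋯ + F(n,k-n+1),
-- so 2F(n,k+1) - 3F(n,k) = T - F(n,k-n).  Since F(n,·) is non-decreasing, T ≥ F(n,k-1) ≥ F(n,k-n).
-- For n ≥ 3 the sum T has two terms, the newest of which is positive, so the inequality is strict;
-- for n = 2 we have T = F(2,k-1), which exceeds F(2,k-2) except for k = 3 (where F(2,2) = 1 > 0)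
-- and k = 4 (where F(2,3) = F(2,2) = 1).
module Submission where

open import Defs
open import Data.Nat
open import Data.Nat.Properties
open import Data.Nat.ListAction using (sum)
open import Data.Nat.Tactic.RingSolver using (solve-∀)
open import Data.List using (_∷_; take)
open import Data.Product using (_×_; _,_)
open import Data.Empty using (⊥-elim)
open import Function.Bundles using (_⇔_; mk⇔)
open import Relation.Nullary using (yes; no)
open import Relation.Binary.PropositionalEquality

hist-suc : ∀ n k → hist n (suc k) ≡ F n (suc k) ∷ hist n k
hist-suc n k with suc k <? n
... | yes _ = refl
... | no _ with suc k ≟ n
...   | yes _ = refl
...   | no _ = refl

F-< : ∀ {n k} → k < n → F n k ≡ 0
F-< {n} {zero} _ = refl
F-< {n} {suc k} k<n with suc k <? n
... | yes _ = refl
... | no k≮n = ⊥-elim (k≮n k<n)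

F-diag : ∀ c → F (suc c) (suc c) ≡ 1
F-diag c with suc c <? suc c
... | yes c<c = ⊥-elim (<-irrefl refl c<c)
... | no _ with suc c ≟ suc c
...   | yes _ = refl
...   | no c≢c = ⊥-elim (c≢c refl)

window : ℕ → ℕ → ℕ → ℕ
window n j k = sum (take j (hist n k))

F-rec : ∀ {n k} → n ≤ k → F n (suc k) ≡ window n n k
F-rec {n} {k} n≤k with suc k <? n
... | yes k<n = ⊥-elim (<-asym (s≤s n≤k) k<n)
... | no _ with suc k ≟ n
...   | yes k≡n = ⊥-elim (<-irrefl (sym k≡n) (s≤s n≤k))
...   | no _ = refl

window-suc : ∀ n j k → window n (suc j) (suc k) ≡ F n (suc k) + window n j k
window-suc n j k rewrite hist-suc n k = refl

window-one : ∀ n k → window n 1 k ≡ F n k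
window-one n zero = refl
window-one n (suc k) rewrite window-suc n 0 k = +-identityʳ (F n (suc k))

window-snoc : ∀ n {j k} → j ≤ k → window n (suc j) k ≡ window n j k + F n (k ∸ j)
window-snoc n {zero} {k} _ = window-one n k
window-snoc n {suc j} {suc k} (s≤s j≤k) = begin
  window n (suc (suc j)) (suc k)         ≡⟨ window-suc n (suc j) k ⟩
  F n (suc k) + window n (suc j) k       ≡⟨ cong (F n (suc k) +_) (window-snoc n j≤k) ⟩
  F n (suc k) + (window n j k + F n (k ∸ j)) ≡⟨ +-assoc (F n (suc k)) _ _ ⟨
  F n (suc k) + window n j k + F n (k ∸ j) ≡⟨ cong (_+ F n (k ∸ j)) (window-suc n j k) ⟨
  window n (suc j) (suc k) + F n (k ∸ j) ∎
  where open ≡-Reasoning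

F≤window : ∀ n j k → F n k ≤ window n (suc j) k
F≤window n j zero = z≤n
F≤window n j (suc k) rewrite window-suc n j k = m≤m+n (F n (suc k)) (window n j k)

F-mono-suc : ∀ c k → F (suc c) k ≤ F (suc c) (suc k)
F-mono-suc c k with k <? suc c
... | yes k<n rewrite F-< k<n = z≤n
... | no k≮n rewrite F-rec (≮⇒≥ k≮n) = F≤window (suc c) c k

F-mono : ∀ c {j k} → j ≤ k → F (suc c) j ≤ F (suc c) k
F-mono c j≤k = go (≤⇒≤′ j≤k)
  where
  go : ∀ {j k} → j ≤′ k → F (suc c) j ≤ F (suc c) k
  go ≤′-refl = ≤-refl
  go (≤′-step {k} j≤′k) = ≤-trans (go j≤′k) (F-mono-suc c k)

F-pos : ∀ c {k} → suc c ≤ k → 1 ≤ F (suc c) k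
F-pos c {k} n≤k = subst (_≤ F (suc c) k) (F-diag c) (F-mono c n≤k)

F-split-oldest : ∀ {c m} → suc c ≤ m → F (suc c) (suc m) ≡ window (suc c) c m + F (suc c) (m ∸ c)
F-split-oldest {c} n≤m = trans (F-rec n≤m) (window-snoc (suc c) (≤-trans (n≤1+n c) n≤m))

F-split-newest : ∀ {c m} → suc c ≤ m → F (suc c) (suc (suc m)) ≡ F (suc c) (suc m) + window (suc c) c m
F-split-newest {c} {m} n≤m = trans (F-rec (m≤n⇒m≤1+n n≤m)) (window-suc (suc c) c m)

F-<-suc : ∀ c {k} → suc (suc c) ≤ k → F (suc (suc c)) (suc k) < F (suc (suc c)) (suc (suc k))
F-<-suc c {k} n≤k = begin-strict
  F n (suc k)                         <⟨ m<m+n (F n (suc k)) (≤-trans (F-pos (suc c) n≤k) (F≤window n c k)) ⟩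
  F n (suc k) + window n (suc c) k    ≡⟨ F-split-newest n≤k ⟨
  F n (suc (suc k))                   ∎
  where
  n = suc (suc c)
  open ≤-Reasoning

F[m∸i]≤window : ∀ c i j m → F (suc c) (m ∸ i) ≤ window (suc c) (suc j) m
F[m∸i]≤window c i j m = ≤-trans (F-mono c (m∸n≤m m i)) (F≤window (suc c) j m)

oldest<window : ∀ d {m} → suc (suc (suc d)) ≤ m
  → F (suc (suc (suc d))) (m ∸ suc (suc d)) < window (suc (suc (suc d))) (suc (suc d)) m
oldest<window d {suc m} n≤m = begin-strict
  F n (m ∸ suc d)                      <⟨ s≤s (F[m∸i]≤window (suc (suc d)) (suc d) d m) ⟩
  1 + window n (suc d) m               ≤⟨ +-monoˡ-≤ _ (F-pos (suc (suc d)) n≤m) ⟩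
  F n (suc m) + window n (suc d) m     ≡⟨ window-suc n (suc d) m ⟨
  window n (suc (suc d)) (suc m)       ∎
  where
  n = suc (suc (suc d))
  open ≤-Reasoning

window≡oldest⇒ : ∀ d {m} → suc (suc d) ≤ m → window (suc (suc d)) (suc d) m ≡ F (suc (suc d)) (m ∸ suc d)
  → suc (suc d) ≡ 2 × suc m ≡ 4
window≡oldest⇒ zero {1} (s≤s ()) _
window≡oldest⇒ zero {2} _ ()
window≡oldest⇒ zero {3} _ _ = refl , refl
window≡oldest⇒ zero {suc (suc (suc (suc e)))} _ eq =
  ⊥-elim (<-irrefl (trans (sym eq) (window-one 2 (4 + e))) (F-<-suc 0 {2 + e} (s≤s (s≤s z≤n))))
window≡oldest⇒ (suc d) n≤m eq = ⊥-elim (<-irrefl (sym eq) (oldest<window d n≤m))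

3[t+a]≡[2[t+a]+t]+a : ∀ t a → 3 * (t + a) ≡ (2 * (t + a) + t) + a
3[t+a]≡[2[t+a]+t]+a = solve-∀

2[t+a+t]≡[2[t+a]+t]+t : ∀ t a → 2 * (t + a + t) ≡ (2 * (t + a) + t) + t
2[t+a+t]≡[2[t+a]+t]+t = solve-∀

3[t+a]≤2[t+a+t] : ∀ {t a} → a ≤ t → 3 * (t + a) ≤ 2 * (t + a + t)
3[t+a]≤2[t+a+t] {t} {a} a≤t
  rewrite 3[t+a]≡[2[t+a]+t]+a t a | 2[t+a+t]≡[2[t+a]+t]+t t a = +-monoʳ-≤ (2 * (t + a) + t) a≤t

3[t+a]≡2[t+a+t]⇒a≡t : ∀ {t a} → 3 * (t + a) ≡ 2 * (t + a + t) → a ≡ t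
3[t+a]≡2[t+a+t]⇒a≡t {t} {a} eq
  rewrite 3[t+a]≡[2[t+a]+t]+a t a | 2[t+a+t]≡[2[t+a]+t]+t t a = +-cancelˡ-≡ (2 * (t + a) + t) a t eq

mainTheorem17 : (n k : ℕ) → 1 < n → n < k →
    (3 * F n k ≤ 2 * F n (k + 1)) × ((3 * F n k ≡ 2 * F n (k + 1)) ⇔ (n ≡ 2 × k ≡ 4))
mainTheorem17 (suc zero) _ (s≤s ()) _
mainTheorem17 (suc (suc d)) (suc m) _ (s≤s n≤m)
  rewrite +-comm m 1 | F-split-newest n≤m | F-split-oldest n≤m =
    3[t+a]≤2[t+a+t] (F[m∸i]≤window (suc d) (suc d) d m) ,
    mk⇔ (λ eq → window≡oldest⇒ d n≤m (sym (3[t+a]≡2[t+a+t]⇒a≡t eq)))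
        (λ { (refl , refl) → refl })
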